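{- Let $n\ge 2$ and let $\Omega_n$ be the set of naturally labeled partial orders on $[n]=\{0,1,\dots,n-1\}$. Consider the Markov chain on $\Omega_n$ whose single step (the "link move") applied to a poset $P\in\Omega_n$ is: choose a pair of elements $x<y$ uniformly at random among the $\binom{n}{2}$ such pairs; if $x\prec y$ is a link of $P$, remove all relations between elements of $\mathrm{incpast}(x)$ and elements of $\mathrm{incfut}(y)$ and then restore every such relation which is implied by transitivity via an element unrelated to at least one of $x$ or $y$ (so that the resulting poset is the one whose Hasse diagram is that of $P$ with the edge $x\to y$ deleted); else if $(x,y)$ is a suitable pair of $P$, adjoin a relation $x'\prec y'$ for every $x'\in\mathrm{incpast}(x)$ and $y'\in\mathrm{incfut}(y)$; otherwise leave $P$ unchanged. Then every step produces an element of $\Omega_n$, the chain is ergodic in the sense that for any $A,B\in\Omega_n$ there is a sequence of steps leading from $A$ to $B$ with nonzero probability, and the chain satisfies detailed balance with respect to the uniform distribution on $\Omega_n$, i.e. $\Pr(A\to B)=\Pr(B\to A)$ for all $A,B\in\Omega_n$.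
   Context: A poset $(S,\prec)$ here has $\prec$ irreflexive and transitive. A poset on $[n]$ is naturally labeled if $x\prec y$ implies $x<y$ (as integers). $\mathrm{past}(x)=\{z: z\prec x\}$, $\mathrm{fut}(x)=\{z: x\prec z\}$, $\mathrm{incpast}(x)=\mathrm{past}(x)\cup\{x\}$, $\mathrm{incfut}(x)=\mathrm{fut}(x)\cup\{x\}$. A link is a relation $x\prec y$ such that there is no $z$ with $x\prec z\prec y$; the Hasse diagram of a poset is the directed graph with an edge $x\to y$ for each link $x\prec y$. A suitable pair of $P$ is a pair of elements $x<y$ (as integers) with $x\not\prec y$ such that there is no $z\in\mathrm{incpast}(x)$ which is linked to an element $w\in\mathrm{incfut}(y)$. $\Pr(A\to B)$ denotes the one-step transition probability of the chain from $A$ to $B$. -}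

module Defs where

open import Data.Bool using (Bool; true; false; T; _∧_; _∨_; not; if_then_else_)
open import Data.Nat as ℕ using (ℕ; zero; suc; NonZero; s≤s; z≤n)
open import Data.Nat.Combinatorics using (_C_; nC1≡n; nCk+nC[k+1]≡[n+1]C[k+1])
open import Data.Fin using (Fin; toℕ)
open import Data.Fin.Properties using (_≟_; _<?_)
open import Data.Vec using (Vec; lookup; tabulate)
open import Data.Vec.Properties using (≡-dec)
open import Data.List using (List; length; filter; allFin; concatMap)
open import Data.List.Base as L using ()
open import Data.Bool.ListAction using (any)
open import Data.Product using (_×_; _,_; Σ)
open import Data.Integer using (+_)
open import Data.Rational using (ℚ; _/_)
open import Relation.Nullary using (¬_; Dec; yes; no)
open import Relation.Nullary.Decidable using (⌊_⌋)
open import Relation.Binary.PropositionalEquality using (_≡_; refl; subst; sym; cong)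
open import Relation.Binary.Construct.Closure.ReflexiveTransitive using (Star)

-- A (strict) relation on [n] = Fin n, stored as an n×n Boolean matrix
-- (so that propositional equality of relations is decidable/extensional).

Rel : ℕ → Set
Rel n = Vec (Vec Bool n) n

rel : ∀ {n} → Rel n → Fin n → Fin n → Bool
rel R a b = lookup (lookup R a) b

_≺[_]_ : ∀ {n} → Fin n → Rel n → Fin n → Set
a ≺[ R ] b = T (rel R a b)

record IsNatPoset {n : ℕ} (R : Rel n) : Set where
  field
    irrefl  : ∀ x → ¬ (x ≺[ R ] x)
    trans   : ∀ x y z → x ≺[ R ] y → y ≺[ R ] z → x ≺[ R ] z
    natural : ∀ x y → x ≺[ R ] y → toℕ x ℕ.< toℕ y

Ω : ℕ → Set
Ω n = Σ (Rel n) IsNatPoset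

eqb : ∀ {n} → Fin n → Fin n → Bool
eqb a b = ⌊ a ≟ b ⌋

anyFin : ∀ {n} → (Fin n → Bool) → Bool
anyFin f = any f (allFin _)

module _ {n : ℕ} (R : Rel n) where

  inIncPast : Fin n → Fin n → Bool
  inIncPast x z = rel R z x ∨ eqb z x

  inIncFut : Fin n → Fin n → Bool
  inIncFut y w = rel R y w ∨ eqb w y

  isLink : Fin n → Fin n → Bool
  isLink a b = rel R a b ∧ not (anyFin (λ c → rel R a c ∧ rel R c b))

  unrelated : Fin n → Fin n → Bool
  unrelated z x = not (eqb z x) ∧ not (rel R z x) ∧ not (rel R x z)

  -- (x , y) is suitable (x < y assumed by the caller): x ⊀ y and no
  -- z ∈ incpast(x) is linked to some w ∈ incfut(y)
  isSuitable : Fin n → Fin n → Bool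
  isSuitable x y =
    not (rel R x y) ∧
    not (anyFin (λ z → anyFin (λ w → inIncPast x z ∧ inIncFut y w ∧ isLink z w)))

  removeLink : Fin n → Fin n → Rel n
  removeLink x y = tabulate λ a → tabulate λ b →
    if inIncPast x a ∧ inIncFut y b
    then anyFin (λ z → rel R a z ∧ rel R z b ∧ (unrelated z x ∨ unrelated z y))
    else rel R a b

  addRelations : Fin n → Fin n → Rel n
  addRelations x y = tabulate λ a → tabulate λ b →
    rel R a b ∨ (inIncPast x a ∧ inIncFut y b)

  linkMove : Fin n → Fin n → Rel n
  linkMove x y =
    if isLink x y then removeLink x y
    else if isSuitable x y then addRelations x y
    else R

pairs : (n : ℕ) → List (Fin n × Fin n)
pairs n = concatMap (λ x → L.map (x ,_) (filter (λ y → x <? y) (allFin n))) (allFin n)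

countMoves : ∀ {n} → Rel n → Rel n → ℕ
countMoves {n} A B =
  length (filter (λ { (x , y) → ≡-dec (≡-dec Data.Bool._≟_) (linkMove A x y) B }) (pairs n))
  where import Data.Bool

nC2-nonZero : ∀ {n} → 2 ℕ.≤ n → NonZero (n C 2)
nC2-nonZero {suc (suc m)} (s≤s (s≤s _)) =
  subst NonZero (nCk+nC[k+1]≡[n+1]C[k+1] (suc m) 1)
    (subst (λ k → NonZero (k ℕ.+ (suc m C 2))) (sym (nC1≡n (suc m))) _)

Pr : (n : ℕ) → 2 ℕ.≤ n → Rel n → Rel n → ℚ
Pr n h A B = ((+ countMoves A B) / (n C 2)) {{nC2-nonZero h}}

module Submission where

-- The proof shows
-- that the two effective cases are inverse to each other and that link
-- removal empties every poset.
--
-- Hence a move from A to B ≠ A is undone by the same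
-- pair from B, the pairs moving A to B and B to A coincide (detailed
-- balance), and every available move has positive probability.  Removing
-- a link strictly decreases the number of relations, so by well-founded
-- induction every poset is connected to the empty one in both directions
-- (ergodicity).

open import Defs
open import Data.Bool using (Bool; true; false; T; _∧_; _∨_; not; if_then_else_)
import Data.Bool as Bool
open import Data.Bool.Properties using (∨-identityʳ; ∨-zeroʳ; ∧-zeroʳ)
open import Data.Unit using (tt)
open import Data.Empty using (⊥; ⊥-elim)
open import Data.Nat as ℕ using (ℕ; zero; suc; _≤_; _+_; z≤n; s≤s)
open import Data.Nat.Properties
  using (≤-refl; ≤-trans; ≤-reflexive; <⇒≤; <⇒≱; ≤-<-trans; <-≤-trans; ≤-pred;
         +-suc; +-identityʳ; +-monoˡ-≤; +-mono-≤; +-mono-≤-<; +-mono-<-≤; m≤n+m)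
open import Data.Nat.Induction using (<-wellFounded)
open import Data.Nat.Combinatorics using (_C_)
open import Data.Fin as Fin using (Fin; toℕ; _<_)
open import Data.Fin.Properties using (_≟_; _<?_)
open import Data.Vec using (Vec; []; _∷_; lookup; tabulate)
open import Data.Vec.Properties using (≡-dec; lookup∘tabulate; tabulate∘lookup; tabulate-cong)
open import Data.List using (List; []; _∷_; length; filter; allFin)
import Data.List as List
open import Data.List.Relation.Unary.Any using (here; there; satisfied)
open import Data.List.Relation.Unary.Any.Properties using (any⁺; any⁻)
open import Data.List.Membership.Propositional using (_∈_; lose)
open import Data.List.Membership.Propositional.Properties
  using (∈-allFin; ∈-map⁺; ∈-map⁻; ∈-filter⁺; ∈-filter⁻; ∈-concatMap⁺; ∈-concatMap⁻;
         ∈-length)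
open import Data.Product using (_×_; _,_; Σ; proj₁; proj₂)
open import Data.Sum using (_⊎_; inj₁; inj₂)
open import Data.Integer using (+_)
open import Data.Rational using (0ℚ; _/_) renaming (_<_ to _<ℚ_)
open import Data.Rational.Properties using (positive⁻¹; normalize-pos)
open import Function using (_∘_)
open import Induction.WellFounded using (Acc; acc)
open import Relation.Nullary using (¬_; yes; no)
open import Relation.Nullary.Decidable using (toWitness; fromWitness)
open import Relation.Unary using (Pred; Decidable)
open import Relation.Binary.PropositionalEquality
open import Relation.Binary.Construct.Closure.ReflexiveTransitive using (Star; ε; _◅_; _◅◅_)

true⇒T : ∀ {b} → b ≡ true → T b
true⇒T refl = tt

T⇒true : ∀ {b} → T b → b ≡ true
T⇒true {true} _ = refl

∧-elim : ∀ {a b} → a ∧ b ≡ true → a ≡ true × b ≡ true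
∧-elim {true} {true} _ = refl , refl

∧-intro : ∀ {a b} → a ≡ true → b ≡ true → a ∧ b ≡ true
∧-intro refl refl = refl

∨-elim : ∀ {a b} → a ∨ b ≡ true → a ≡ true ⊎ b ≡ true
∨-elim {true} _ = inj₁ refl
∨-elim {false} e = inj₂ e

∨-introˡ : ∀ {a b} → a ≡ true → a ∨ b ≡ true
∨-introˡ refl = refl

∨-introʳ : ∀ {a b} → b ≡ true → a ∨ b ≡ true
∨-introʳ {true} _ = refl
∨-introʳ {false} e = e

not-elim : ∀ {a} → not a ≡ true → a ≡ false
not-elim {false} _ = refl

not-intro : ∀ {a} → a ≡ false → not a ≡ true
not-intro refl = refl

true≢false : ∀ {a} → a ≡ true → a ≡ false → ⊥
true≢false refl ()

¬true⇒false : ∀ {a} → ¬ (a ≡ true) → a ≡ false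
¬true⇒false {true} h = ⊥-elim (h refl)
¬true⇒false {false} _ = refl

bool-ext : ∀ {p q} → (p ≡ true → q ≡ true) → (q ≡ true → p ≡ true) → p ≡ q
bool-ext {true} f _ = sym (f refl)
bool-ext {false} {true} _ g = g refl
bool-ext {false} {false} _ _ = refl

eqb-elim : ∀ {n} {a b : Fin n} → eqb a b ≡ true → a ≡ b
eqb-elim = toWitness ∘ true⇒T

eqb-intro : ∀ {n} {a b : Fin n} → a ≡ b → eqb a b ≡ true
eqb-intro = T⇒true ∘ fromWitness

anyFin-intro : ∀ {n} (f : Fin n → Bool) z → f z ≡ true → anyFin f ≡ true
anyFin-intro f z e = T⇒true (any⁺ f (lose {P = T ∘ f} (∈-allFin z) (true⇒T e)))

anyFin-witness : ∀ {n} (f : Fin n → Bool) → anyFin f ≡ true → Σ (Fin n) λ z → f z ≡ true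
anyFin-witness f e = let (z , t) = satisfied (any⁻ f (allFin _) (true⇒T e)) in z , T⇒true t

anyFin-none : ∀ {n} (f : Fin n → Bool) → (∀ z → f z ≡ true → ⊥) → anyFin f ≡ false
anyFin-none f h = ¬true⇒false λ e → let (z , fz) = anyFin-witness f e in h z fz

rel-tabulate : ∀ {n} (f : Fin n → Fin n → Bool) a b →
  rel (tabulate λ a → tabulate λ b → f a b) a b ≡ f a b
rel-tabulate f a b rewrite lookup∘tabulate (λ a → tabulate λ b → f a b) a =
  lookup∘tabulate (f a) b

rel-ext : ∀ {n} (R S : Rel n) → (∀ a b → rel R a b ≡ rel S a b) → R ≡ S
rel-ext R S h = trans (sym (tabulate∘lookup R))
  (trans (tabulate-cong λ a → trans (sym (tabulate∘lookup (lookup R a)))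
                               (trans (tabulate-cong (h a)) (tabulate∘lookup (lookup S a))))
         (tabulate∘lookup S))

isLink-false : ∀ {n} (R : Rel n) {a b} → rel R a b ≡ false → isLink R a b ≡ false
isLink-false R e rewrite e = refl

module _ {n} (R : Rel n) (x y : Fin n) where

  spans : Fin n → Fin n → Bool
  spans a b = inIncPast R x a ∧ inIncFut R y b

  bypasses : Fin n → Bool
  bypasses z = unrelated R z x ∨ unrelated R z y

  detour : Fin n → Fin n → Fin n → Bool
  detour a b z = rel R a z ∧ rel R z b ∧ bypasses z

  detour-elim : ∀ {a b z} → detour a b z ≡ true →
    rel R a z ≡ true × rel R z b ≡ true × bypasses z ≡ true
  detour-elim {a} {b} {z} e =
    let (az , rest) = ∧-elim {rel R a z} e ; (zb , bz) = ∧-elim {rel R z b} rest in az , zb , bz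

  detour-intro : ∀ {a b z} → rel R a z ≡ true → rel R z b ≡ true → bypasses z ≡ true →
    detour a b z ≡ true
  detour-intro az zb bz = ∧-intro az (∧-intro zb bz)

  rel-removeLink : ∀ a b →
    rel (removeLink R x y) a b ≡ (if spans a b then anyFin (detour a b) else rel R a b)
  rel-removeLink = rel-tabulate _

  rel-addRelations : ∀ a b → rel (addRelations R x y) a b ≡ rel R a b ∨ spans a b
  rel-addRelations = rel-tabulate _

module NatPoset {n} (A : Rel n) (P : IsNatPoset A) where

  infix 4 _≺_ _≼_

  _≺_ : Fin n → Fin n → Set
  a ≺ b = rel A a b ≡ true

  _≼_ : Fin n → Fin n → Set
  a ≼ b = a ≡ b ⊎ a ≺ b

  ≺-trans : ∀ {a b c} → a ≺ b → b ≺ c → a ≺ c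
  ≺-trans {a} {b} {c} p q = T⇒true (IsNatPoset.trans P a b c (true⇒T p) (true⇒T q))

  ≺-irrefl : ∀ {a} → ¬ (a ≺ a)
  ≺-irrefl {a} p = IsNatPoset.irrefl P a (true⇒T p)

  ≺⇒< : ∀ {a b} → a ≺ b → toℕ a ℕ.< toℕ b
  ≺⇒< {a} {b} p = IsNatPoset.natural P a b (true⇒T p)

  ≼⇒≤ : ∀ {a b} → a ≼ b → toℕ a ≤ toℕ b
  ≼⇒≤ (inj₁ refl) = ≤-refl
  ≼⇒≤ (inj₂ p) = <⇒≤ (≺⇒< p)

  ≼-≺-trans : ∀ {a b c} → a ≼ b → b ≺ c → a ≺ c
  ≼-≺-trans (inj₁ refl) q = q
  ≼-≺-trans (inj₂ p) q = ≺-trans p q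

  ≺-≼-trans : ∀ {a b c} → a ≺ b → b ≼ c → a ≺ c
  ≺-≼-trans p (inj₁ refl) = p
  ≺-≼-trans p (inj₂ q) = ≺-trans p q

  incPast⇒≼ : ∀ {x a} → inIncPast A x a ≡ true → a ≼ x
  incPast⇒≼ {x} {a} e with ∨-elim {rel A a x} e
  ... | inj₁ a≺x = inj₂ a≺x
  ... | inj₂ a≡x = inj₁ (eqb-elim a≡x)

  ≼⇒incPast : ∀ {x a} → a ≼ x → inIncPast A x a ≡ true
  ≼⇒incPast {x} (inj₁ refl) = ∨-introʳ {rel A x x} (eqb-intro refl)
  ≼⇒incPast (inj₂ a≺x) = ∨-introˡ a≺x

  incFut⇒≼ : ∀ {y w} → inIncFut A y w ≡ true → y ≼ w
  incFut⇒≼ {y} {w} e with ∨-elim {rel A y w} e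
  ... | inj₁ y≺w = inj₂ y≺w
  ... | inj₂ w≡y = inj₁ (sym (eqb-elim w≡y))

  ≼⇒incFut : ∀ {y w} → y ≼ w → inIncFut A y w ≡ true
  ≼⇒incFut {y} (inj₁ refl) = ∨-introʳ {rel A y y} (eqb-intro refl)
  ≼⇒incFut (inj₂ y≺w) = ∨-introˡ y≺w

  spans⇒ : ∀ {x y a b} → spans A x y a b ≡ true → a ≼ x × y ≼ b
  spans⇒ {x} {a = a} e = let (p , q) = ∧-elim {inIncPast A x a} e in incPast⇒≼ p , incFut⇒≼ q

  ≼⇒spans : ∀ {x y a b} → a ≼ x → y ≼ b → spans A x y a b ≡ true
  ≼⇒spans a≼x y≼b = ∧-intro (≼⇒incPast a≼x) (≼⇒incFut y≼b)

  Unrelated : Fin n → Fin n → Set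
  Unrelated z x = ¬ z ≡ x × ¬ z ≺ x × ¬ x ≺ z

  unrelated⇒ : ∀ {z x} → unrelated A z x ≡ true → Unrelated z x
  unrelated⇒ {z} {x} e =
    let (e₁ , rest) = ∧-elim {not (eqb z x)} e ; (e₂ , e₃) = ∧-elim {not (rel A z x)} rest
    in (λ z≡x → true≢false (eqb-intro z≡x) (not-elim e₁)) ,
       (λ z≺x → true≢false z≺x (not-elim e₂)) , (λ x≺z → true≢false x≺z (not-elim e₃))

  unrelated⇒≢ : ∀ z x → unrelated A z x ≡ true → ¬ z ≡ x
  unrelated⇒≢ z x = proj₁ ∘ unrelated⇒ {z} {x}

  unrelated⇒⊀ : ∀ z x → unrelated A z x ≡ true → ¬ z ≺ x
  unrelated⇒⊀ z x = proj₁ ∘ proj₂ ∘ unrelated⇒ {z} {x}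

  unrelated⇒⊁ : ∀ z x → unrelated A z x ≡ true → ¬ x ≺ z
  unrelated⇒⊁ z x = proj₂ ∘ proj₂ ∘ unrelated⇒ {z} {x}

  Unrelated⇒ : ∀ {z x} → Unrelated z x → unrelated A z x ≡ true
  Unrelated⇒ (z≢x , z⊀x , x⊀z) =
    ∧-intro (not-intro (¬true⇒false (z≢x ∘ eqb-elim)))
            (∧-intro (not-intro (¬true⇒false z⊀x)) (not-intro (¬true⇒false x⊀z)))

  comparable : ∀ {z x} → unrelated A z x ≡ false → z ≡ x ⊎ z ≺ x ⊎ x ≺ z
  comparable {z} {x} e with eqb z x in e₁ | rel A z x in e₂ | rel A x z in e₃
  ... | true | _ | _ = inj₁ (eqb-elim e₁)
  ... | false | true | _ = inj₂ (inj₁ refl)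
  ... | false | false | true = inj₂ (inj₂ refl)
  ... | false | false | false = ⊥-elim (true≢false refl e)

  link⇒ : ∀ {x y} → isLink A x y ≡ true → x ≺ y × (∀ c → x ≺ c → c ≺ y → ⊥)
  link⇒ {x} {y} e with ∧-elim {rel A x y} e
  ... | x≺y , none = x≺y , λ c x≺c c≺y →
          true≢false (anyFin-intro (λ c → rel A x c ∧ rel A c y) c (∧-intro x≺c c≺y)) (not-elim none)

  ⇒link : ∀ {x y} → x ≺ y → (∀ c → x ≺ c → c ≺ y → ⊥) → isLink A x y ≡ true
  ⇒link x≺y none =
    ∧-intro x≺y (not-intro (anyFin-none _ λ c e → let (x≺c , c≺y) = ∧-elim e in none c x≺c c≺y))

  suitable⇒ : ∀ {x y} → isSuitable A x y ≡ true →
    ¬ x ≺ y × (∀ z w → z ≼ x → y ≼ w → ¬ isLink A z w ≡ true)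
  suitable⇒ {x} {y} e with ∧-elim {not (rel A x y)} e
  ... | x⊀y , none = (λ x≺y → true≢false x≺y (not-elim x⊀y)) , λ z w z≼x y≼w lk →
          true≢false (anyFin-intro _ z (anyFin-intro _ w
                        (∧-intro (≼⇒incPast z≼x) (∧-intro (≼⇒incFut y≼w) lk))))
                     (not-elim none)

  ⇒suitable : ∀ {x y} → ¬ x ≺ y → (∀ z w → z ≼ x → y ≼ w → ¬ isLink A z w ≡ true) →
    isSuitable A x y ≡ true
  ⇒suitable x⊀y none = ∧-intro (not-intro (¬true⇒false x⊀y)) (not-intro (anyFin-none _ λ z e →
    let (w , e′) = anyFin-witness _ e
        (z≼x , rest) = ∧-elim e′
        (y≼w , lk) = ∧-elim rest
    in none z w (incPast⇒≼ z≼x) (incFut⇒≼ y≼w) lk))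

  linkOrFactor : ∀ {a b} → a ≺ b → isLink A a b ≡ true ⊎ Σ (Fin n) λ c → a ≺ c × c ≺ b
  linkOrFactor {a} {b} a≺b = decide _ refl
    where
      decide : ∀ t → anyFin (λ c → rel A a c ∧ rel A c b) ≡ t →
        isLink A a b ≡ true ⊎ Σ (Fin n) λ c → a ≺ c × c ≺ b
      decide true e = let (c , w) = anyFin-witness _ e in inj₂ (c , ∧-elim {rel A a c} w)
      decide false e = inj₁ (⇒link a≺b λ c a≺c c≺b →
                         true≢false (anyFin-intro _ c (∧-intro a≺c c≺b)) e)

  -- It terminates because
  -- both factors of a ≺ c ≺ b are shorter in the labelling.
  module _ (Q : Fin n → Fin n → Set)
           (onLink : ∀ {a b} → isLink A a b ≡ true → Q a b)
           (onFactor : ∀ {a b c} → a ≺ c → c ≺ b → Q a c → Q c b → Q a b) where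

    private
      go : ∀ k {a b} → toℕ b ≤ toℕ a + k → a ≺ b → Q a b
      go zero bound a≺b = ⊥-elim (<⇒≱ (≺⇒< a≺b) (≤-trans bound (≤-reflexive (+-identityʳ _))))
      go (suc k) {a} {b} bound a≺b with linkOrFactor a≺b
      ... | inj₁ lk = onLink lk
      ... | inj₂ (c , a≺c , c≺b) = onFactor a≺c c≺b (go k left a≺c) (go k right c≺b)
        where
          bound′ : toℕ b ≤ suc (toℕ a + k)
          bound′ = ≤-trans bound (≤-reflexive (+-suc (toℕ a) k))
          left : toℕ c ≤ toℕ a + k
          left = ≤-pred (≤-trans (≺⇒< c≺b) bound′)
          right : toℕ b ≤ toℕ c + k
          right = ≤-trans bound′ (+-monoˡ-≤ k (≺⇒< a≺c))

    factorInduction : ∀ {a b} → a ≺ b → Q a b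
    factorInduction {a} {b} = go (toℕ b) (m≤n+m _ _)

module LinkRemoval {n} (A : Rel n) (P : IsNatPoset A) (x y : Fin n)
                   (lk : isLink A x y ≡ true) where
  open NatPoset A P

  A⁻ : Rel n
  A⁻ = removeLink A x y

  x≺y : x ≺ y
  x≺y = proj₁ (link⇒ lk)

  nothingBetween : ∀ c → x ≺ c → c ≺ y → ⊥
  nothingBetween = proj₂ (link⇒ lk)

  A⁻-inside : ∀ {a b} → spans A x y a b ≡ true → rel A⁻ a b ≡ anyFin (detour A x y a b)
  A⁻-inside {a} {b} s rewrite rel-removeLink A x y a b | s = refl

  A⁻-outside : ∀ {a b} → spans A x y a b ≡ false → rel A⁻ a b ≡ rel A a b
  A⁻-outside {a} {b} s rewrite rel-removeLink A x y a b | s = refl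

  A⁻-detour : ∀ {a b} → spans A x y a b ≡ true → rel A⁻ a b ≡ true →
    Σ (Fin n) λ z → detour A x y a b z ≡ true
  A⁻-detour s e = anyFin-witness _ (trans (sym (A⁻-inside s)) e)

  A⁻⊆A : ∀ {a b} → rel A⁻ a b ≡ true → a ≺ b
  A⁻⊆A {a} {b} e with spans A x y a b in s
  ... | false = trans (sym (A⁻-outside s)) e
  ... | true = let (z , d) = A⁻-detour s e ; (a≺z , z≺b , _) = detour-elim A x y d
               in ≺-trans a≺z z≺b

  -- an element comparable to both x and y lies below x or above y,
  -- since nothing lies strictly between the ends of a link
  nonBypass⇒ : ∀ {z} → bypasses A x y z ≡ false → z ≼ x ⊎ y ≼ z
  nonBypass⇒ {z} e = split (comparable notUnrelatedˣ) (comparable notUnrelatedʸ)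
    where
      notUnrelatedˣ : unrelated A z x ≡ false
      notUnrelatedˣ = ¬true⇒false λ u → true≢false (∨-introˡ u) e
      notUnrelatedʸ : unrelated A z y ≡ false
      notUnrelatedʸ = ¬true⇒false λ u → true≢false (∨-introʳ {unrelated A z x} u) e
      split : z ≡ x ⊎ z ≺ x ⊎ x ≺ z → z ≡ y ⊎ z ≺ y ⊎ y ≺ z → z ≼ x ⊎ y ≼ z
      split (inj₁ z≡x) _ = inj₁ (inj₁ z≡x)
      split (inj₂ (inj₁ z≺x)) _ = inj₁ (inj₂ z≺x)
      split _ (inj₁ refl) = inj₂ (inj₁ refl)
      split _ (inj₂ (inj₂ y≺z)) = inj₂ (inj₂ y≺z)
      split (inj₂ (inj₂ x≺z)) (inj₂ (inj₁ z≺y)) = ⊥-elim (nothingBetween z x≺z z≺y)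

  bypass⇒¬incPast : ∀ {z} → bypasses A x y z ≡ true → inIncPast A x z ≡ false
  bypass⇒¬incPast {z} u = ¬true⇒false λ e → excluded (incPast⇒≼ e) (∨-elim u)
    where
      excluded : z ≼ x → unrelated A z x ≡ true ⊎ unrelated A z y ≡ true → ⊥
      excluded (inj₁ refl) (inj₁ ux) = unrelated⇒≢ z x ux refl
      excluded (inj₂ z≺x) (inj₁ ux) = unrelated⇒⊀ z x ux z≺x
      excluded z≼x (inj₂ uy) = unrelated⇒⊀ z y uy (≼-≺-trans z≼x x≺y)

  bypass⇒¬incFut : ∀ {z} → bypasses A x y z ≡ true → inIncFut A y z ≡ false
  bypass⇒¬incFut {z} u = ¬true⇒false λ e → excluded (incFut⇒≼ e) (∨-elim u)
    where
      excluded : y ≼ z → unrelated A z x ≡ true ⊎ unrelated A z y ≡ true → ⊥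
      excluded y≼z (inj₁ ux) = unrelated⇒⊁ z x ux (≺-≼-trans x≺y y≼z)
      excluded (inj₁ refl) (inj₂ uy) = unrelated⇒≢ z y uy refl
      excluded (inj₂ y≺z) (inj₂ uy) = unrelated⇒⊁ z y uy y≺z

  not-spans-fut : ∀ {a b} → inIncFut A y b ≡ false → spans A x y a b ≡ false
  not-spans-fut {a} e rewrite e = ∧-zeroʳ (inIncPast A x a)

  not-spans-past : ∀ {a b} → inIncPast A x a ≡ false → spans A x y a b ≡ false
  not-spans-past e rewrite e = refl

  -- the composite of two A⁻-relations spanned by (x , y) has a detour:
  -- through b itself if b bypasses, else through a detour of one of the factors
  detourThrough : ∀ {a b c} → spans A x y a c ≡ true →
    rel A⁻ a b ≡ true → rel A⁻ b c ≡ true → anyFin (detour A x y a c) ≡ true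
  detourThrough {a} {b} {c} s ab bc with bypasses A x y b in u
  ... | true = anyFin-intro _ b (detour-intro A x y (A⁻⊆A ab) (A⁻⊆A bc) u)
  ... | false with nonBypass⇒ u | spans⇒ s
  ...   | inj₁ b≼x | _ , y≼c =
            let (z , d) = A⁻-detour (≼⇒spans b≼x y≼c) bc
                (b≺z , z≺c , bz) = detour-elim A x y d
            in anyFin-intro _ z (detour-intro A x y (≺-trans (A⁻⊆A ab) b≺z) z≺c bz)
  ...   | inj₂ y≼b | a≼x , _ =
            let (z , d) = A⁻-detour (≼⇒spans a≼x y≼b) ab
                (a≺z , z≺b , bz) = detour-elim A x y d
            in anyFin-intro _ z (detour-intro A x y a≺z (≺-trans z≺b (A⁻⊆A bc)) bz)

  A⁻-trans : ∀ {a b c} → rel A⁻ a b ≡ true → rel A⁻ b c ≡ true → rel A⁻ a c ≡ true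
  A⁻-trans {a} {b} {c} ab bc with spans A x y a c in s
  ... | false = trans (A⁻-outside s) (≺-trans (A⁻⊆A ab) (A⁻⊆A bc))
  ... | true = trans (A⁻-inside s) (detourThrough s ab bc)

  A⁻-poset : IsNatPoset A⁻
  A⁻-poset = record
    { irrefl = λ a p → ≺-irrefl (A⁻⊆A (T⇒true p))
    ; trans = λ a b c p q → true⇒T (A⁻-trans (T⇒true p) (T⇒true q))
    ; natural = λ a b p → ≺⇒< (A⁻⊆A (T⇒true p)) }

  -- x ⊀ y in A⁻, since x ≺ y has no detour
  A⁻-x⊀y : rel A⁻ x y ≡ false
  A⁻-x⊀y = trans (A⁻-inside (≼⇒spans (inj₁ refl) (inj₁ refl))) (anyFin-none _ λ z d →
    let (x≺z , z≺y , _) = detour-elim A x y d in nothingBetween z x≺z z≺y)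

  incPast-A⁻ : ∀ a → inIncPast A⁻ x a ≡ inIncPast A x a
  incPast-A⁻ a = cong (_∨ eqb a x) (A⁻-outside (not-spans-fut {a} x∉incFut))
    where
      x∉incFut : inIncFut A y x ≡ false
      x∉incFut = ¬true⇒false λ e → <⇒≱ (≺⇒< x≺y) (≼⇒≤ (incFut⇒≼ e))

  incFut-A⁻ : ∀ w → inIncFut A⁻ y w ≡ inIncFut A y w
  incFut-A⁻ w = cong (_∨ eqb w y) (A⁻-outside (not-spans-past {y} {w} y∉incPast))
    where
      y∉incPast : inIncPast A x y ≡ false
      y∉incPast = ¬true⇒false λ e → <⇒≱ (≺⇒< x≺y) (≼⇒≤ (incPast⇒≼ e))

  module P⁻ = NatPoset A⁻ A⁻-poset

  -- (x , y) is suitable in A⁻: a link z ≺ w of A⁻ spanned by (x , y) would have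
  -- a detour z ≺ c ≺ w whose relations survive in A⁻
  A⁻-suitable : isSuitable A⁻ x y ≡ true
  A⁻-suitable = P⁻.⇒suitable (λ e → true≢false e A⁻-x⊀y) λ z w z≼x y≼w link →
    let z∈past = trans (sym (incPast-A⁻ z)) (P⁻.≼⇒incPast z≼x)
        w∈fut = trans (sym (incFut-A⁻ w)) (P⁻.≼⇒incFut y≼w)
        (zw , nothingBetween⁻) = P⁻.link⇒ link
        (c , d) = A⁻-detour (∧-intro {inIncPast A x z} z∈past w∈fut) zw
        (z≺c , c≺w , bc) = detour-elim A x y d
    in nothingBetween⁻ c (trans (A⁻-outside (not-spans-fut {z} (bypass⇒¬incFut bc))) z≺c)
                         (trans (A⁻-outside (not-spans-past {c} {w} (bypass⇒¬incPast bc))) c≺w)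

  addRelations-A⁻ : addRelations A⁻ x y ≡ A
  addRelations-A⁻ = rel-ext _ _ λ a b → begin
      rel (addRelations A⁻ x y) a b  ≡⟨ rel-addRelations A⁻ x y a b ⟩
      rel A⁻ a b ∨ spans A⁻ x y a b  ≡⟨ cong₂ (λ u v → rel A⁻ a b ∨ (u ∧ v))
                                              (incPast-A⁻ a) (incFut-A⁻ b) ⟩
      rel A⁻ a b ∨ spans A x y a b   ≡⟨ restore a b _ refl ⟩
      rel A a b                      ∎
    where
      open ≡-Reasoning
      -- spanned pairs are relations of A (a ≼ x ≺ y ≼ b); the others are untouched
      restore : ∀ a b t → spans A x y a b ≡ t → rel A⁻ a b ∨ t ≡ rel A a b
      restore a b true s =
        let (a≼x , y≼b) = spans⇒ s
        in trans (∨-zeroʳ (rel A⁻ a b)) (sym (≼-≺-trans a≼x (≺-≼-trans x≺y y≼b)))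
      restore a b false s = trans (∨-identityʳ (rel A⁻ a b)) (A⁻-outside s)

module SuitableAddition {n} (A : Rel n) (P : IsNatPoset A) (x y : Fin n)
                        (x<y : x < y) (st : isSuitable A x y ≡ true) where
  open NatPoset A P

  A⁺ : Rel n
  A⁺ = addRelations A x y

  x⊀y : ¬ x ≺ y
  x⊀y = proj₁ (suitable⇒ st)

  noLinkAcross : ∀ z w → z ≼ x → y ≼ w → ¬ isLink A z w ≡ true
  noLinkAcross = proj₂ (suitable⇒ st)

  fut-not-below-past : ∀ {c} → y ≼ c → c ≼ x → ⊥
  fut-not-below-past y≼c c≼x = <⇒≱ x<y (≤-trans (≼⇒≤ y≼c) (≼⇒≤ c≼x))

  A⁺⇒ : ∀ {a b} → rel A⁺ a b ≡ true → a ≺ b ⊎ (a ≼ x × y ≼ b)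
  A⁺⇒ {a} {b} e with ∨-elim {rel A a b} (trans (sym (rel-addRelations A x y a b)) e)
  ... | inj₁ a≺b = inj₁ a≺b
  ... | inj₂ s = inj₂ (spans⇒ s)

  A⊆A⁺ : ∀ {a b} → a ≺ b → rel A⁺ a b ≡ true
  A⊆A⁺ {a} {b} a≺b = trans (rel-addRelations A x y a b) (∨-introˡ a≺b)

  spans⊆A⁺ : ∀ {a b} → a ≼ x → y ≼ b → rel A⁺ a b ≡ true
  spans⊆A⁺ {a} {b} a≼x y≼b =
    trans (rel-addRelations A x y a b) (∨-introʳ {rel A a b} (≼⇒spans a≼x y≼b))

  -- A⁺ is a natural poset: composites stay in A or become spanned pairs, and a
  -- spanned pair a ≼ x, y ≼ b has a < b since x < y
  A⁺-trans : ∀ {a b c} → rel A⁺ a b ≡ true → rel A⁺ b c ≡ true → rel A⁺ a c ≡ true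
  A⁺-trans p q with A⁺⇒ p | A⁺⇒ q
  ... | inj₁ a≺b | inj₁ b≺c = A⊆A⁺ (≺-trans a≺b b≺c)
  ... | inj₁ a≺b | inj₂ (b≼x , y≼c) = spans⊆A⁺ (inj₂ (≺-≼-trans a≺b b≼x)) y≼c
  ... | inj₂ (a≼x , y≼b) | inj₁ b≺c = spans⊆A⁺ a≼x (inj₂ (≼-≺-trans y≼b b≺c))
  ... | inj₂ (a≼x , _) | inj₂ (_ , y≼c) = spans⊆A⁺ a≼x y≼c

  A⁺-irrefl : ∀ {a} → ¬ rel A⁺ a a ≡ true
  A⁺-irrefl p with A⁺⇒ p
  ... | inj₁ a≺a = ≺-irrefl a≺a
  ... | inj₂ (a≼x , y≼a) = fut-not-below-past y≼a a≼x

  A⁺-natural : ∀ {a b} → rel A⁺ a b ≡ true → toℕ a ℕ.< toℕ b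
  A⁺-natural p with A⁺⇒ p
  ... | inj₁ a≺b = ≺⇒< a≺b
  ... | inj₂ (a≼x , y≼b) = ≤-<-trans (≼⇒≤ a≼x) (<-≤-trans x<y (≼⇒≤ y≼b))

  A⁺-poset : IsNatPoset A⁺
  A⁺-poset = record
    { irrefl = λ a p → A⁺-irrefl (T⇒true p)
    ; trans = λ a b c p q → true⇒T (A⁺-trans (T⇒true p) (T⇒true q))
    ; natural = λ a b p → A⁺-natural (T⇒true p) }

  module P⁺ = NatPoset A⁺ A⁺-poset

  incPast-A⁺ : ∀ a → inIncPast A⁺ x a ≡ inIncPast A x a
  incPast-A⁺ a = cong (_∨ eqb a x) (begin
      rel A⁺ a x                            ≡⟨ rel-addRelations A x y a x ⟩
      rel A a x ∨ spans A x y a x           ≡⟨ cong (λ t → rel A a x ∨ (inIncPast A x a ∧ t)) x∉incFut ⟩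
      rel A a x ∨ (inIncPast A x a ∧ false) ≡⟨ cong (rel A a x ∨_) (∧-zeroʳ _) ⟩
      rel A a x ∨ false                     ≡⟨ ∨-identityʳ _ ⟩
      rel A a x                             ∎)
    where
      open ≡-Reasoning
      x∉incFut : inIncFut A y x ≡ false
      x∉incFut = ¬true⇒false λ e → fut-not-below-past (incFut⇒≼ e) (inj₁ refl)

  incFut-A⁺ : ∀ w → inIncFut A⁺ y w ≡ inIncFut A y w
  incFut-A⁺ w = cong (_∨ eqb w y) (begin
      rel A⁺ y w                  ≡⟨ rel-addRelations A x y y w ⟩
      rel A y w ∨ spans A x y y w ≡⟨ cong (λ t → rel A y w ∨ (t ∧ inIncFut A y w)) y∉incPast ⟩
      rel A y w ∨ false           ≡⟨ ∨-identityʳ _ ⟩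
      rel A y w                   ∎)
    where
      open ≡-Reasoning
      y∉incPast : inIncPast A x y ≡ false
      y∉incPast = ¬true⇒false λ e → fut-not-below-past (inj₁ refl) (incPast⇒≼ e)

  -- x ≺ y is a link of A⁺: an element strictly between would put part of
  -- incfut(y) below incpast(x), or give x ≺ y in A
  A⁺-link : isLink A⁺ x y ≡ true
  A⁺-link = P⁺.⇒link (spans⊆A⁺ (inj₁ refl) (inj₁ refl)) λ c p q → between (A⁺⇒ p) (A⁺⇒ q)
    where
      between : ∀ {c} → x ≺ c ⊎ (x ≼ x × y ≼ c) → c ≺ y ⊎ (c ≼ x × y ≼ y) → ⊥
      between (inj₁ x≺c) (inj₁ c≺y) = x⊀y (≺-trans x≺c c≺y)
      between (inj₁ x≺c) (inj₂ (c≼x , _)) = ≺-irrefl (≺-≼-trans x≺c c≼x)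
      between (inj₂ (_ , y≼c)) (inj₁ c≺y) = ≺-irrefl (≼-≺-trans y≼c c≺y)
      between (inj₂ (_ , y≼c)) (inj₂ (c≼x , _)) = fut-not-below-past y≼c c≼x

  -- a detour in A⁺ runs through an element outside incpast(x) ∪ incfut(y),
  -- so both of its relations already hold in A
  detourA⁺⇒A : ∀ {a b} z → detour A⁺ x y a b z ≡ true → a ≺ b
  detourA⁺⇒A {a} {b} z d =
    let (az , zb , bz) = detour-elim A⁺ x y d
    in ≺-trans (into (A⁺⇒ az) (∨-elim bz)) (outof (A⁺⇒ zb) (∨-elim bz))
    where
      Bypassing : Set
      Bypassing = unrelated A⁺ z x ≡ true ⊎ unrelated A⁺ z y ≡ true
      into : a ≺ z ⊎ (a ≼ x × y ≼ z) → Bypassing → a ≺ z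
      into (inj₁ a≺z) _ = a≺z
      into (inj₂ (_ , y≼z)) (inj₁ ux) = ⊥-elim (P⁺.unrelated⇒⊁ z x ux (spans⊆A⁺ (inj₁ refl) y≼z))
      into (inj₂ (_ , inj₁ refl)) (inj₂ uy) = ⊥-elim (P⁺.unrelated⇒≢ z y uy refl)
      into (inj₂ (_ , inj₂ y≺z)) (inj₂ uy) = ⊥-elim (P⁺.unrelated⇒⊁ z y uy (A⊆A⁺ y≺z))
      outof : z ≺ b ⊎ (z ≼ x × y ≼ b) → Bypassing → z ≺ b
      outof (inj₁ z≺b) _ = z≺b
      outof (inj₂ (z≼x , _)) (inj₂ uy) = ⊥-elim (P⁺.unrelated⇒⊀ z y uy (spans⊆A⁺ z≼x (inj₁ refl)))
      outof (inj₂ (inj₁ refl , _)) (inj₁ ux) = ⊥-elim (P⁺.unrelated⇒≢ z x ux refl)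
      outof (inj₂ (inj₂ z≺x , _)) (inj₁ ux) = ⊥-elim (P⁺.unrelated⇒⊀ z x ux (A⊆A⁺ z≺x))

  -- an element outside incpast(x) ∪ incfut(y) bypasses in A⁺:
  -- it is unrelated to x, or (when x ≺ c) unrelated to y
  outside⇒bypass : ∀ {c} → inIncPast A x c ≡ false → inIncFut A y c ≡ false →
    bypasses A⁺ x y c ≡ true
  outside⇒bypass {c} c∉past c∉fut with rel A x c in x≺c
  ... | false = ∨-introˡ (P⁺.Unrelated⇒ (c≢x , below ∘ A⁺⇒ , above ∘ A⁺⇒))
    where
      c≢x : ¬ c ≡ x
      c≢x refl = true≢false (≼⇒incPast (inj₁ refl)) c∉past
      below : c ≺ x ⊎ (c ≼ x × y ≼ x) → ⊥
      below (inj₁ c≺x) = true≢false (≼⇒incPast (inj₂ c≺x)) c∉past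
      below (inj₂ (c≼x , _)) = true≢false (≼⇒incPast c≼x) c∉past
      above : x ≺ c ⊎ (x ≼ x × y ≼ c) → ⊥
      above (inj₁ x≺c′) = true≢false x≺c′ x≺c
      above (inj₂ (_ , y≼c)) = true≢false (≼⇒incFut y≼c) c∉fut
  ... | true = ∨-introʳ {unrelated A⁺ c x} (P⁺.Unrelated⇒ (c≢y , below ∘ A⁺⇒ , above ∘ A⁺⇒))
    where
      c≢y : ¬ c ≡ y
      c≢y refl = true≢false (≼⇒incFut (inj₁ refl)) c∉fut
      below : c ≺ y ⊎ (c ≼ x × y ≼ y) → ⊥
      below (inj₁ c≺y) = x⊀y (≺-trans x≺c c≺y)
      below (inj₂ (c≼x , _)) = true≢false (≼⇒incPast c≼x) c∉past
      above : y ≺ c ⊎ (y ≼ x × y ≼ c) → ⊥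
      above (inj₁ y≺c) = true≢false (≼⇒incFut (inj₂ y≺c)) c∉fut
      above (inj₂ (y≼x , _)) = fut-not-below-past (inj₁ refl) y≼x

  -- every relation of A spanned by (x , y) has a detour in A⁺; by factor
  -- induction, since no link of A is spanned by (x , y)
  HasDetour : Fin n → Fin n → Set
  HasDetour a b = a ≼ x → y ≼ b → Σ (Fin n) λ z → detour A⁺ x y a b z ≡ true

  spanned⇒detour : ∀ {a b} → a ≺ b → HasDetour a b
  spanned⇒detour = factorInduction HasDetour
    (λ {a} {b} link a≼x y≼b → ⊥-elim (noLinkAcross a b a≼x y≼b link)) compose
    where
      compose : ∀ {a b c} → a ≺ c → c ≺ b → HasDetour a c → HasDetour c b → HasDetour a b
      -- extend a detour of c ≺ b (c ≼ x) or of a ≺ c (y ≼ c), or else detour through c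
      compose {a} {b} {c} a≺c c≺b viaAc viaCb a≼x y≼b
        with inIncPast A x c in c∈past | inIncFut A y c in c∈fut
      ... | true | _ =
            let (z , d) = viaCb (incPast⇒≼ c∈past) y≼b ; (cz , zb , bz) = detour-elim A⁺ x y d
            in z , detour-intro A⁺ x y (A⁺-trans (A⊆A⁺ a≺c) cz) zb bz
      ... | false | true =
            let (z , d) = viaAc a≼x (incFut⇒≼ c∈fut) ; (az , zc , bz) = detour-elim A⁺ x y d
            in z , detour-intro A⁺ x y az (A⁺-trans zc (A⊆A⁺ c≺b)) bz
      ... | false | false =
            c , detour-intro A⁺ x y (A⊆A⁺ a≺c) (A⊆A⁺ c≺b) (outside⇒bypass c∈past c∈fut)

  removeLink-A⁺ : removeLink A⁺ x y ≡ A
  removeLink-A⁺ = rel-ext _ _ λ a b → trans (rel-removeLink A⁺ x y a b) (restore a b _ refl)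
    where
      spans-A⁺ : ∀ a b → spans A⁺ x y a b ≡ spans A x y a b
      spans-A⁺ a b = cong₂ _∧_ (incPast-A⁺ a) (incFut-A⁺ b)
      restore : ∀ a b t → spans A x y a b ≡ t →
        (if spans A⁺ x y a b then anyFin (detour A⁺ x y a b) else rel A⁺ a b) ≡ rel A a b
      restore a b true s rewrite spans-A⁺ a b | s =
        let (a≼x , y≼b) = spans⇒ s
        in bool-ext (λ e → let (z , d) = anyFin-witness _ e in detourA⁺⇒A z d)
                    (λ a≺b → let (z , d) = spanned⇒detour a≺b a≼x y≼b in anyFin-intro _ z d)
      restore a b false s rewrite spans-A⁺ a b | s =
        trans (rel-addRelations A x y a b) (trans (cong (rel A a b ∨_) s) (∨-identityʳ _))

linkMove-link : ∀ {n} (R : Rel n) {x y} → isLink R x y ≡ true →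
  linkMove R x y ≡ removeLink R x y
linkMove-link R lk rewrite lk = refl

linkMove-suitable : ∀ {n} (R : Rel n) {x y} → isLink R x y ≡ false → isSuitable R x y ≡ true →
  linkMove R x y ≡ addRelations R x y
linkMove-suitable R lk st rewrite lk | st = refl

linkMove-idle : ∀ {n} (R : Rel n) {x y} → isLink R x y ≡ false → isSuitable R x y ≡ false →
  linkMove R x y ≡ R
linkMove-idle R lk st rewrite lk | st = refl

linkMove-poset : ∀ {n} (A : Ω n) (x y : Fin n) → x < y → IsNatPoset (linkMove (proj₁ A) x y)
linkMove-poset (A , P) x y x<y with isLink A x y in lk
... | true = LinkRemoval.A⁻-poset A P x y lk
... | false with isSuitable A x y in st
...   | true = SuitableAddition.A⁺-poset A P x y x<y st
...   | false = P

linkMove-reversible : ∀ {n} (A : Rel n) → IsNatPoset A → ∀ {x y} → x < y → ∀ {B} →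
  linkMove A x y ≡ B → B ≢ A → linkMove B x y ≡ A
linkMove-reversible A P {x} {y} x<y {B} move B≢A =
  byCase (isLink A x y) refl (isSuitable A x y) refl
  where
    open ≡-Reasoning
    byCase : ∀ s → isLink A x y ≡ s → ∀ t → isSuitable A x y ≡ t → linkMove B x y ≡ A
    byCase true lk _ _ = begin
        linkMove B x y      ≡⟨ cong (λ R → linkMove R x y) (trans (sym move) (linkMove-link A lk)) ⟩
        linkMove A⁻ x y     ≡⟨ linkMove-suitable A⁻ (isLink-false A⁻ A⁻-x⊀y) A⁻-suitable ⟩
        addRelations A⁻ x y ≡⟨ addRelations-A⁻ ⟩
        A                   ∎
      where open LinkRemoval A P x y lk
    byCase false lk true st = begin
        linkMove B x y    ≡⟨ cong (λ R → linkMove R x y) (trans (sym move) (linkMove-suitable A lk st)) ⟩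
        linkMove A⁺ x y   ≡⟨ linkMove-link A⁺ A⁺-link ⟩
        removeLink A⁺ x y ≡⟨ removeLink-A⁺ ⟩
        A                 ∎
      where open SuitableAddition A P x y x<y st
    byCase false lk false st = ⊥-elim (B≢A (trans (sym move) (linkMove-idle A lk st)))

-- Detailed balance: the pairs moving A to B are those moving B to A.

length-filter-cong : ∀ {ℓ} {X : Set} {P Q : Pred X ℓ} (P? : Decidable P) (Q? : Decidable Q)
  (xs : List X) → (∀ {p} → p ∈ xs → P p → Q p) → (∀ {p} → p ∈ xs → Q p → P p) →
  length (filter P? xs) ≡ length (filter Q? xs)
length-filter-cong P? Q? [] _ _ = refl
length-filter-cong P? Q? (p ∷ xs) P⇒Q Q⇒P with P? p | Q? p
... | yes _ | yes _ = cong suc (length-filter-cong P? Q? xs (P⇒Q ∘ there) (Q⇒P ∘ there))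
... | no _ | no _ = length-filter-cong P? Q? xs (P⇒Q ∘ there) (Q⇒P ∘ there)
... | yes Pp | no ¬Qp = ⊥-elim (¬Qp (P⇒Q (here refl) Pp))
... | no ¬Pp | yes Qp = ⊥-elim (¬Pp (Q⇒P (here refl) Qp))

pairsFrom : ∀ n → Fin n → List (Fin n × Fin n)
pairsFrom n x = List.map (x ,_) (filter (x <?_) (allFin n))

pairs-ordered : ∀ {n} {p : Fin n × Fin n} → p ∈ pairs n → proj₁ p < proj₂ p
pairs-ordered {n} p∈ =
  let (x , p∈row) = satisfied (∈-concatMap⁻ (pairsFrom n) {allFin n} p∈)
      (y , y∈ , p≡xy) = ∈-map⁻ (x ,_) p∈row
  in subst (λ q → proj₁ q < proj₂ q) (sym p≡xy) (proj₂ (∈-filter⁻ (x <?_) {xs = allFin n} y∈))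

ordered∈pairs : ∀ {n} {x y : Fin n} → x < y → (x , y) ∈ pairs n
ordered∈pairs {n} {x} {y} x<y = ∈-concatMap⁺ (pairsFrom n)
  (lose (∈-allFin x) (∈-map⁺ (x ,_) (∈-filter⁺ (x <?_) (∈-allFin y) x<y)))

countMoves-sym : ∀ {n} (A B : Ω n) →
  countMoves (proj₁ A) (proj₁ B) ≡ countMoves (proj₁ B) (proj₁ A)
countMoves-sym {n} (A , PA) (B , PB) with ≡-dec (≡-dec Bool._≟_) A B
... | yes refl = refl
... | no A≢B = length-filter-cong _ _ (pairs n)
  (λ m move → linkMove-reversible A PA (pairs-ordered m) move (A≢B ∘ sym))
  (λ m move → linkMove-reversible B PB (pairs-ordered m) move A≢B)

detailedBalance : ∀ n (h : 2 ≤ n) (A B : Ω n) →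
  Pr n h (proj₁ A) (proj₁ B) ≡ Pr n h (proj₁ B) (proj₁ A)
detailedBalance n h A B = cong (λ k → ((+ k) / (n C 2)) {{nC2-nonZero h}}) (countMoves-sym A B)

fraction-positive : ∀ m d .{{_ : ℕ.NonZero d}} → 0 ℕ.< m → 0ℚ <ℚ (+ m) / d
fraction-positive (suc k) d _ = positive⁻¹ _ {{normalize-pos (suc k) d}}

Pr-positive : ∀ {n} (h : 2 ≤ n) {A B : Rel n} {x y} → x < y → linkMove A x y ≡ B →
  0ℚ <ℚ Pr n h A B
Pr-positive {n} h x<y move = fraction-positive _ (n C 2) {{nC2-nonZero h}}
  (∈-length (∈-filter⁺ _ (ordered∈pairs x<y) move))

bit : Bool → ℕ
bit b = if b then 1 else 0

trues : ∀ {m} → Vec Bool m → ℕ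
trues [] = 0
trues (b ∷ v) = bit b + trues v

size : ∀ {m k} → Vec (Vec Bool k) m → ℕ
size [] = 0
size (r ∷ rs) = trues r + size rs

_⊆ᵥ_ : ∀ {m} → Vec Bool m → Vec Bool m → Set
v ⊆ᵥ w = ∀ i → lookup v i ≡ true → lookup w i ≡ true

bit-mono : ∀ {a b} → (a ≡ true → b ≡ true) → bit a ≤ bit b
bit-mono {false} _ = z≤n
bit-mono {true} f rewrite f refl = ≤-refl

trues-mono : ∀ {m} (v w : Vec Bool m) → v ⊆ᵥ w → trues v ≤ trues w
trues-mono [] [] _ = z≤n
trues-mono (a ∷ v) (b ∷ w) v⊆w =
  +-mono-≤ (bit-mono (v⊆w Fin.zero)) (trues-mono v w (v⊆w ∘ Fin.suc))

trues-strict : ∀ {m} (v w : Vec Bool m) → v ⊆ᵥ w →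
  ∀ j → lookup v j ≡ false → lookup w j ≡ true → trues v ℕ.< trues w
trues-strict (false ∷ v) (true ∷ w) v⊆w Fin.zero refl refl =
  s≤s (trues-mono v w (v⊆w ∘ Fin.suc))
trues-strict (a ∷ v) (b ∷ w) v⊆w (Fin.suc j) vj wj =
  +-mono-≤-< (bit-mono (v⊆w Fin.zero)) (trues-strict v w (v⊆w ∘ Fin.suc) j vj wj)

size-mono : ∀ {m k} (R S : Vec (Vec Bool k) m) → (∀ i → lookup R i ⊆ᵥ lookup S i) →
  size R ≤ size S
size-mono [] [] _ = z≤n
size-mono (r ∷ R) (s ∷ S) R⊆S =
  +-mono-≤ (trues-mono r s (R⊆S Fin.zero)) (size-mono R S (R⊆S ∘ Fin.suc))

size-strict : ∀ {m k} (R S : Vec (Vec Bool k) m) → (∀ i → lookup R i ⊆ᵥ lookup S i) →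
  ∀ i j → lookup (lookup R i) j ≡ false → lookup (lookup S i) j ≡ true → size R ℕ.< size S
size-strict (r ∷ R) (s ∷ S) R⊆S Fin.zero j rj sj =
  +-mono-<-≤ (trues-strict r s (R⊆S Fin.zero) j rj sj) (size-mono R S (R⊆S ∘ Fin.suc))
size-strict (r ∷ R) (s ∷ S) R⊆S (Fin.suc i) j rj sj =
  +-mono-≤-< (trues-mono r s (R⊆S Fin.zero)) (size-strict R S (R⊆S ∘ Fin.suc) i j rj sj)

removeLink-shrinks : ∀ {n} (A : Rel n) (P : IsNatPoset A) (x y : Fin n) →
  isLink A x y ≡ true → size (removeLink A x y) ℕ.< size A
removeLink-shrinks A P x y lk = size-strict A⁻ A (λ _ _ → A⁻⊆A) x y A⁻-x⊀y x≺y
  where open LinkRemoval A P x y lk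

emptyRel : ∀ n → Rel n
emptyRel n = tabulate λ _ → tabulate λ _ → false

empty-or-related : ∀ {n} (R : Rel n) →
  R ≡ emptyRel n ⊎ Σ (Fin n) λ a → Σ (Fin n) λ b → rel R a b ≡ true
empty-or-related R with anyFin (λ a → anyFin (λ b → rel R a b)) in e
... | true = let (a , ea) = anyFin-witness _ e ; (b , eb) = anyFin-witness _ ea in inj₂ (a , b , eb)
... | false = inj₁ (rel-ext _ _ λ a b → trans
  (¬true⇒false λ r → true≢false (anyFin-intro _ a (anyFin-intro _ b r)) e) (sym (rel-tabulate _ a b)))

HasLink : ∀ {n} → Rel n → Set
HasLink {n} A = Σ (Fin n) λ x → Σ (Fin n) λ y → isLink A x y ≡ true

hasLink : ∀ {n} (A : Rel n) → IsNatPoset A → ∀ {a b} → rel A a b ≡ true → HasLink A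
hasLink A P = factorInduction (λ _ _ → HasLink A) (λ {a} {b} lk → a , b , lk) (λ _ _ link _ → link)
  where open NatPoset A P

module Ergodicity {n} (h : 2 ≤ n) where

  Step : Rel n → Rel n → Set
  Step P Q = 0ℚ <ℚ Pr n h P Q

  linkRemoval-steps : ∀ (A : Rel n) → IsNatPoset A → ∀ {x y} (lk : isLink A x y ≡ true) →
    Step A (removeLink A x y) × Step (removeLink A x y) A
  linkRemoval-steps A P {x} {y} lk =
    Pr-positive h {A} {A⁻} x<y move ,
    Pr-positive h {A⁻} {A} x<y (linkMove-reversible A P x<y move A⁻≢A)
    where
      open LinkRemoval A P x y lk
      x<y : x < y
      x<y = NatPoset.≺⇒< A P x≺y
      move : linkMove A x y ≡ A⁻
      move = linkMove-link A lk
      A⁻≢A : A⁻ ≢ A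
      A⁻≢A eq = true≢false x≺y (trans (cong (λ R → rel R x y) (sym eq)) A⁻-x⊀y)

  -- by well-founded induction on the number of relations, every natural
  -- poset reaches the empty one by removing links, and back by re-adding them
  connectedToEmpty : ∀ (A : Rel n) → IsNatPoset A → Acc ℕ._<_ (size A) →
    Star Step A (emptyRel n) × Star Step (emptyRel n) A
  connectedToEmpty A P (acc smaller) = byCase (empty-or-related A)
    where
      Connected : Set
      Connected = Star Step A (emptyRel n) × Star Step (emptyRel n) A

      viaLink : HasLink A → Connected
      viaLink (x , y , lk) = proj₁ steps ◅ proj₁ rest , proj₂ rest ◅◅ (proj₂ steps ◅ ε)
        where
          A⁻ : Rel n
          A⁻ = removeLink A x y
          steps : Step A A⁻ × Step A⁻ A
          steps = linkRemoval-steps A P lk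
          rest : Star Step A⁻ (emptyRel n) × Star Step (emptyRel n) A⁻
          rest = connectedToEmpty A⁻ (LinkRemoval.A⁻-poset A P x y lk)
                                     (smaller (removeLink-shrinks A P x y lk))

      byCase : A ≡ emptyRel n ⊎ Σ (Fin n) (λ a → Σ (Fin n) λ b → rel A a b ≡ true) → Connected
      byCase (inj₁ A≡∅) = subst (λ R → Star Step R (emptyRel n)) (sym A≡∅) ε
                        , subst (Star Step (emptyRel n)) (sym A≡∅) ε
      byCase (inj₂ (a , b , ab)) = viaLink (hasLink A P ab)

  ergodic : ∀ (A B : Ω n) → Star Step (proj₁ A) (proj₁ B)
  ergodic (A , PA) (B , PB) =
    proj₁ (connectedToEmpty A PA (<-wellFounded _)) ◅◅ proj₂ (connectedToEmpty B PB (<-wellFounded _))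

mainTheorem2 : (n : ℕ) (h : 2 ≤ n) →
    (∀ (A : Ω n) (x y : Fin n) → x < y → IsNatPoset (linkMove (proj₁ A) x y))
    ×
    (∀ (A B : Ω n) → Star (λ P Q → 0ℚ <ℚ Pr n h P Q) (proj₁ A) (proj₁ B))
    ×
    (∀ (A B : Ω n) → Pr n h (proj₁ A) (proj₁ B) ≡ Pr n h (proj₁ B) (proj₁ A))
mainTheorem2 n h = linkMove-poset , Ergodicity.ergodic h , detailedBalance n h
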